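{- Let $\mathbb{D}$ be a Euclidean domain. Every consistent instance of $\textsc{2-Lin}(\mathbb{D})$ admits a homogenizing variable substitution.
   Context: An instance $S$ of $\textsc{2-Lin}(\mathbb{D})$ is a finite set of equations $ax+by=c$ with $a,b,c\in D$. An equation is homogeneous if $c=0$; an instance is homogeneous if all its equations are. A variable substitution for $S$ is a map $\Phi$ replacing every variable $x\in V(S)$ by $a_xx'+b_x$ for some $a_x,b_x\in D$ ($x'$ a new variable); $\Phi(S)$ is the resulting instance (in the variables $x'$). $\Phi$ is homogenizing if $\Phi(S)$ is homogeneous. -}

module Defs where

open import Level using (Level; _⊔_; suc)
open import Algebra.Bundles using (CommutativeRing)
open import Data.Nat using (ℕ; _<_)
open import Data.Fin using (Fin)
open import Data.List using (List; map)
open import Data.List.Relation.Unary.All using (All)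
open import Data.Product using (Σ; ∃; ∃-syntax; _×_)
open import Data.Sum using (_⊎_)
open import Relation.Nullary using (¬_)

record EuclideanDomain (c ℓ : Level) : Set (suc (c ⊔ ℓ)) where
  field
    commutativeRing : CommutativeRing c ℓ
  open CommutativeRing commutativeRing public
  field
    1≉0           : ¬ (1# ≈ 0#)
    noZeroDivisor : ∀ a b → (a * b) ≈ 0# → (a ≈ 0#) ⊎ (b ≈ 0#)
    norm          : Carrier → ℕ
    division      : ∀ a b → ¬ (b ≈ 0#) →
                    ∃[ q ] ∃[ r ] ((a ≈ ((b * q) + r)) × ((r ≈ 0#) ⊎ (norm r < norm b)))

module TwoLin {d ℓ : Level} (𝔻 : EuclideanDomain d ℓ) where
  open EuclideanDomain 𝔻

  record Equation (n : ℕ) : Set d where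
    constructor eqn
    field
      a : Carrier
      x : Fin n
      b : Carrier
      y : Fin n
      c : Carrier

  Instance : ℕ → Set d
  Instance n = List (Equation n)

  Assignment : ℕ → Set d
  Assignment n = Fin n → Carrier

  Satisfies : ∀ {n} → Assignment n → Equation n → Set ℓ
  Satisfies σ e = ((a * σ x) + (b * σ y)) ≈ c
    where open Equation e

  Consistent : ∀ {n} → Instance n → Set (d ⊔ ℓ)
  Consistent {n} S = ∃[ σ ] All (Satisfies σ) S

  HomogeneousEq : ∀ {n} → Equation n → Set ℓ
  HomogeneousEq e = Equation.c e ≈ 0#

  Homogeneous : ∀ {n} → Instance n → Set (d ⊔ ℓ)
  Homogeneous S = All HomogeneousEq S

  -- A variable substitution replaces each variable x by  aₓ·x' + bₓ.
  record Substitution (n : ℕ) : Set d where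
    constructor subst
    field
      coeff  : Fin n → Carrier
      offset : Fin n → Carrier

  -- a(aₓx' + bₓ) + b(a_y y' + b_y) = c  becomes
  -- (a·aₓ)x' + (b·a_y)y' = c − a·bₓ − b·b_y.
  applyEq : ∀ {n} → Substitution n → Equation n → Equation n
  applyEq Φ (eqn a x b y c) =
    eqn (a * coeff x) x (b * coeff y) y ((c - (a * offset x)) - (b * offset y))
    where open Substitution Φ

  apply : ∀ {n} → Substitution n → Instance n → Instance n
  apply Φ S = map (applyEq Φ) S

  Homogenizing : ∀ {n} → Instance n → Substitution n → Set (d ⊔ ℓ)
  Homogenizing S Φ = Homogeneous (apply Φ S)

{-# OPTIONS --safe #-}
module Submission where

open import Defs
open import Level using (Level)
open import Data.Nat using (ℕ)
open import Data.Product using (∃-syntax; _,_)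
open import Data.List.Relation.Unary.All using (All)
open import Data.List.Relation.Unary.All.Properties using (gmap⁺)
open import Algebra.Bundles using (AbelianGroup)
import Algebra.Properties.AbelianGroup as AbelianGroupProperties
import Relation.Binary.Reasoning.Setoid as SetoidReasoning

-- Shifting every variable by the value of a fixed solution σ, i.e. x ↦ x' + σ(x),
-- turns each right-hand side c into c − a·σ(x) − b·σ(y), which is 0 because σ solves the equation.

module _ {a ℓ} (G : AbelianGroup a ℓ) where
  open AbelianGroup G
  open AbelianGroupProperties G
  open SetoidReasoning setoid

  x∙y≈z⇒z∙x⁻¹∙y⁻¹≈ε : ∀ {x y z} → x ∙ y ≈ z → z ∙ x ⁻¹ ∙ y ⁻¹ ≈ ε
  x∙y≈z⇒z∙x⁻¹∙y⁻¹≈ε {x} {y} {z} x∙y≈z = begin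
    z ∙ x ⁻¹ ∙ y ⁻¹   ≈⟨ assoc z (x ⁻¹) (y ⁻¹) ⟩
    z ∙ (x ⁻¹ ∙ y ⁻¹) ≈⟨ ∙-congˡ (⁻¹-∙-comm x y) ⟩
    z ∙ (x ∙ y) ⁻¹    ≈⟨ ∙-congˡ (⁻¹-cong x∙y≈z) ⟩
    z ∙ z ⁻¹          ≈⟨ inverseʳ z ⟩
    ε                 ∎

module _ {c ℓ : Level} (𝔻 : EuclideanDomain c ℓ) where
  open EuclideanDomain 𝔻
  open TwoLin 𝔻

  translateBy : ∀ {n} → Assignment n → Substitution n
  translateBy σ = subst (λ _ → 1#) σ

  translateBy-homogeneousEq : ∀ {n} {σ : Assignment n} {e : Equation n} →
                              Satisfies σ e → HomogeneousEq (applyEq (translateBy σ) e)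
  translateBy-homogeneousEq {e = eqn _ _ _ _ _} = x∙y≈z⇒z∙x⁻¹∙y⁻¹≈ε +-abelianGroup

  translateBy-homogenizing : ∀ {n} (σ : Assignment n) (S : Instance n) →
                             All (Satisfies σ) S → Homogenizing S (translateBy σ)
  translateBy-homogenizing σ S = gmap⁺ (translateBy-homogeneousEq {σ = σ})

mainTheorem16 : ∀ {c ℓ : Level} (𝔻 : EuclideanDomain c ℓ) (n : ℕ) (S : TwoLin.Instance 𝔻 n) →
    TwoLin.Consistent 𝔻 S → ∃[ Φ ] TwoLin.Homogenizing 𝔻 S Φ
mainTheorem16 𝔻 n S (σ , σ⊨S) = translateBy 𝔻 σ , translateBy-homogenizing 𝔻 σ S σ⊨S
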